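{- Let $S=q_1\cdots q_s$ be a square-free positive integer whose prime factors satisfy $q_i\equiv 1 \pmod 3$ for all $i$. Then there is no point $[x:y:z]\in\mathbb{P}^2(\mathbb{Q})$ with integer representative $(x,y,z)$, $\gcd(x,y,z)=1$, $xyz\neq 0$, every prime factor of $xyz$ belonging to $\{q_1,\dots,q_s\}$, and $16x+y+z=0$. In particular the $S$-unit equation $16X+Y+Z$ has no (proper) points.
   Context: A proper point of the $S$-unit equation $16X+Y+Z$ (for $S$ a finite set of primes) is a point $[x:y:z]\in\mathbb{P}^2(\mathbb{Q})$ with integer representative $(x,y,z)$, $\gcd(x,y,z)=1$, such that $16x+y+z=0$, $xyz\neq 0$, the set of primes dividing $xyz$ is exactly $S$, and $16x,y,z$ are pairwise coprime. -}

module Defs where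

open import Data.Nat using (ℕ; _*_)
open import Data.Nat.Divisibility using (_∣_)
open import Data.Nat.Primality using (Prime)
open import Relation.Nullary using (¬_)

SquareFree : ℕ → Set
SquareFree n = ∀ p → Prime p → ¬ (p * p ∣ n)

module Submission where

-- Every prime factor of x*y*z is ≡ 1 (mod 3), and the set of
-- naturals ≡ 1 (mod 3) is closed under products, so each of |x|, |y|, |z|
-- (divisors of the nonzero number |xyz|) is ≡ 1 (mod 3), and so is |16x|.
-- On the other hand, three integers u, v, w with u + v + w = 0 always have
-- two of the same sign, so one absolute value is the sum of the other two.
-- Applied to u = 16x, v = y, w = z this gives a + b = c with a, b, c all
-- ≡ 1 (mod 3), i.e. 2 ≡ 1 (mod 3), which is absurd.

open import Defs
open import Data.Nat using (ℕ; _%_; _≥_)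
open import Data.Nat.Divisibility using (_∣_)
open import Data.Nat.Primality using (Prime)
open import Data.Integer using (ℤ; +_; ∣_∣; _+_; _*_; 0ℤ; 1ℤ)
open import Data.Integer.GCD using (gcd)
open import Data.Product using (∃; _×_)
open import Relation.Nullary using (¬_)
open import Relation.Binary.PropositionalEquality using (_≡_; _≢_)

open import Data.Nat as ℕ using (suc; NonZero)
import Data.Nat.Properties as ℕ
open import Data.Nat.DivMod using (%-distribˡ-+; %-distribˡ-*)
open import Data.Nat.Divisibility using (∣-trans; m∣m*n; n∣m*n; n∣m*n*o; 0∣⇒≡0)
open import Data.Nat.ListAction using (product)
open import Data.Nat.ListAction.Properties using (∈⇒∣product)
open import Data.Nat.Primality.Factorisation using (factorise; PrimeFactorisation)
open import Data.Integer using (-_; -[1+_]; sign)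
import Data.Integer.Properties as ℤ
open import Data.Sign using (Sign)
open import Data.List using (List; []; _∷_)
open import Data.List.Relation.Unary.All as All using (All; []; _∷_)
open import Data.Product using (_,_)
open import Data.Sum using (_⊎_; inj₁; inj₂; [_,_]′)
open import Data.Empty using (⊥-elim)
open import Relation.Binary.PropositionalEquality
  using (refl; sym; trans; cong; cong₂; subst; module ≡-Reasoning)

*-≡1-mod : ∀ m .{{_ : NonZero m}} a b →
  a % m ≡ 1 % m → b % m ≡ 1 % m → (a ℕ.* b) % m ≡ 1 % m
*-≡1-mod m a b a≡1 b≡1 = begin
  (a ℕ.* b) % m               ≡⟨ %-distribˡ-* a b m ⟩
  ((a % m) ℕ.* (b % m)) % m   ≡⟨ cong₂ (λ s t → (s ℕ.* t) % m) a≡1 b≡1 ⟩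
  ((1 % m) ℕ.* (1 % m)) % m   ≡⟨ %-distribˡ-* 1 1 m ⟨
  1 % m                       ∎
  where open ≡-Reasoning

product-≡1-mod : ∀ m .{{_ : NonZero m}} (ns : List ℕ) →
  All (λ n → n % m ≡ 1 % m) ns → product ns % m ≡ 1 % m
product-≡1-mod m []       []         = refl
product-≡1-mod m (n ∷ ns) (n≡1 ∷ ns≡1) =
  *-≡1-mod m n (product ns) n≡1 (product-≡1-mod m ns ns≡1)

-- A positive number all of whose prime factors are ≡ 1 (mod m) is itself
-- ≡ 1 (mod m): it is the product of its prime factorisation.
prime-factors-≡1-mod : ∀ m .{{_ : NonZero m}} n .{{_ : NonZero n}} →
  (∀ p → Prime p → p ∣ n → p % m ≡ 1 % m) → n % m ≡ 1 % m
prime-factors-≡1-mod m n primes≡1 =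
  subst (λ k → k % m ≡ 1 % m) (sym n≡product) (product-≡1-mod m factors factors≡1)
  where
  open PrimeFactorisation (factorise n)
    renaming (isFactorisation to n≡product)
  factors≡1 : All (λ p → p % m ≡ 1 % m) factors
  factors≡1 = All.tabulate λ {p} p∈factors →
    primes≡1 p (All.lookup factorsPrime p∈factors)
      (subst (p ∣_) (sym n≡product) (∈⇒∣product p∈factors))

divisor-≡1-mod : ∀ m .{{_ : NonZero m}} d n → n ≢ 0 → d ∣ n →
  (∀ p → Prime p → p ∣ n → p % m ≡ 1 % m) → d % m ≡ 1 % m
divisor-≡1-mod m 0         n n≢0 0∣n _ = ⊥-elim (n≢0 (0∣⇒≡0 0∣n))
divisor-≡1-mod m d@(suc _) n n≢0 d∣n primes≡1 =
  prime-factors-≡1-mod m d (λ p p-prime p∣d → primes≡1 p p-prime (∣-trans p∣d d∣n))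

sum-≢-mod3 : ∀ a b c → a % 3 ≡ 1 → b % 3 ≡ 1 → c % 3 ≡ 1 → a ℕ.+ b ≢ c
sum-≢-mod3 a b c a≡1 b≡1 c≡1 a+b≡c = 2≢1 (begin
  2                         ≡⟨ cong₂ (λ s t → (s ℕ.+ t) % 3) a≡1 b≡1 ⟨
  ((a % 3) ℕ.+ (b % 3)) % 3 ≡⟨ %-distribˡ-+ a b 3 ⟨
  (a ℕ.+ b) % 3             ≡⟨ cong (_% 3) a+b≡c ⟩
  c % 3                     ≡⟨ c≡1 ⟩
  1                         ∎)
  where
  open ≡-Reasoning
  2≢1 : 2 ≢ 1
  2≢1 ()

∣+∣-same-sign : ∀ i j → sign i ≡ sign j → ∣ i + j ∣ ≡ ∣ i ∣ ℕ.+ ∣ j ∣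
∣+∣-same-sign (+ m)    (+ n)    _ = refl
∣+∣-same-sign -[1+ m ] -[1+ n ] _ = cong suc (sym (ℕ.+-suc m n))

two-equal-signs : (s t r : Sign) → s ≡ t ⊎ s ≡ r ⊎ t ≡ r
two-equal-signs Sign.+ Sign.+ _      = inj₁ refl
two-equal-signs Sign.- Sign.- _      = inj₁ refl
two-equal-signs Sign.+ Sign.- Sign.+ = inj₂ (inj₁ refl)
two-equal-signs Sign.- Sign.+ Sign.- = inj₂ (inj₁ refl)
two-equal-signs Sign.+ Sign.- Sign.- = inj₂ (inj₂ refl)
two-equal-signs Sign.- Sign.+ Sign.+ = inj₂ (inj₂ refl)

zero-sum-∣∣ : ∀ i j k → i + j + k ≡ 0ℤ → ∣ i + j ∣ ≡ ∣ k ∣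
zero-sum-∣∣ i j k sum≡0 = trans (cong ∣_∣ i+j≡-k) (ℤ.∣-i∣≡∣i∣ k)
  where
  open ≡-Reasoning
  i+j≡-k : i + j ≡ - k
  i+j≡-k = begin
    i + j                ≡⟨ ℤ.+-identityʳ (i + j) ⟨
    i + j + 0ℤ           ≡⟨ cong (_+_ (i + j)) (ℤ.+-inverseʳ k) ⟨
    i + j + (k + - k)    ≡⟨ ℤ.+-assoc (i + j) k (- k) ⟨
    i + j + k + - k      ≡⟨ cong (_+ - k) sum≡0 ⟩
    0ℤ + - k             ≡⟨ ℤ.+-identityˡ (- k) ⟩
    - k                  ∎

-- Of three integers summing to zero, one has absolute value equal to the
-- sum of the absolute values of the other two (take the two of equal sign).
zero-sum-split : ∀ u v w → u + v + w ≡ 0ℤ →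
  ∣ u ∣ ℕ.+ ∣ v ∣ ≡ ∣ w ∣ ⊎ ∣ u ∣ ℕ.+ ∣ w ∣ ≡ ∣ v ∣ ⊎ ∣ v ∣ ℕ.+ ∣ w ∣ ≡ ∣ u ∣
zero-sum-split u v w sum≡0 with two-equal-signs (sign u) (sign v) (sign w)
... | inj₁ su≡sv =
  inj₁ (trans (sym (∣+∣-same-sign u v su≡sv)) (zero-sum-∣∣ u v w sum≡0))
... | inj₂ (inj₁ su≡sw) =
  inj₂ (inj₁ (trans (sym (∣+∣-same-sign u w su≡sw)) (zero-sum-∣∣ u w v uwv≡0)))
  where
  uwv≡0 : u + w + v ≡ 0ℤ
  uwv≡0 = begin
    u + w + v    ≡⟨ ℤ.+-assoc u w v ⟩
    u + (w + v)  ≡⟨ cong (_+_ u) (ℤ.+-comm w v) ⟩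
    u + (v + w)  ≡⟨ ℤ.+-assoc u v w ⟨
    u + v + w    ≡⟨ sum≡0 ⟩
    0ℤ           ∎
    where open ≡-Reasoning
... | inj₂ (inj₂ sv≡sw) =
  inj₂ (inj₂ (trans (sym (∣+∣-same-sign v w sv≡sw)) (zero-sum-∣∣ v w u vwu≡0)))
  where
  vwu≡0 : v + w + u ≡ 0ℤ
  vwu≡0 = begin
    v + w + u    ≡⟨ ℤ.+-comm (v + w) u ⟩
    u + (v + w)  ≡⟨ ℤ.+-assoc u v w ⟨
    u + v + w    ≡⟨ sum≡0 ⟩
    0ℤ           ∎
    where open ≡-Reasoning

lemma1p8 : (S : ℕ) → S ≥ 1 → SquareFree S →
    (∀ q → Prime q → q ∣ S → q % 3 ≡ 1) →
    ¬ (∃ λ (x : ℤ) → ∃ λ (y : ℤ) → ∃ λ (z : ℤ) →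
    (gcd (gcd x y) z ≡ 1ℤ)
    × (x * y * z ≢ 0ℤ)
    × (∀ p → Prime p → p ∣ ∣ x * y * z ∣ → p ∣ S)
    × (+ 16 * x + y + z ≡ 0ℤ))
lemma1p8 S _ _ S-primes≡1 (x , y , z , _ , xyz≢0 , xyz-primes∣S , equation) =
  [ sum-≢-mod3 (∣ 16x ∣) (∣ y ∣) (∣ z ∣) 16x≡1 y≡1 z≡1
  , [ sum-≢-mod3 (∣ 16x ∣) (∣ z ∣) (∣ y ∣) 16x≡1 z≡1 y≡1
    , sum-≢-mod3 (∣ y ∣) (∣ z ∣) (∣ 16x ∣) y≡1 z≡1 16x≡1 ]′ ]′
  (zero-sum-split 16x y z equation)
  where
  16x : ℤ
  16x = + 16 * x
  ∣xyz∣≡ : ∣ x * y * z ∣ ≡ ∣ x ∣ ℕ.* ∣ y ∣ ℕ.* ∣ z ∣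
  ∣xyz∣≡ = trans (ℤ.abs-* (x * y) z) (cong (ℕ._* ∣ z ∣) (ℤ.abs-* x y))
  divisor≡1 : ∀ d → d ∣ ∣ x ∣ ℕ.* ∣ y ∣ ℕ.* ∣ z ∣ → d % 3 ≡ 1
  divisor≡1 d d∣xyz = divisor-≡1-mod 3 d ∣ x * y * z ∣
    (λ ∣xyz∣≡0 → xyz≢0 (ℤ.∣i∣≡0⇒i≡0 ∣xyz∣≡0))
    (subst (d ∣_) (sym ∣xyz∣≡) d∣xyz)
    (λ p p-prime p∣xyz → S-primes≡1 p p-prime (xyz-primes∣S p p-prime p∣xyz))
  y≡1 : ∣ y ∣ % 3 ≡ 1
  y≡1 = divisor≡1 ∣ y ∣ (n∣m*n*o ∣ x ∣ ∣ z ∣)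
  z≡1 : ∣ z ∣ % 3 ≡ 1
  z≡1 = divisor≡1 ∣ z ∣ (n∣m*n (∣ x ∣ ℕ.* ∣ y ∣))
  16x≡1 : ∣ 16x ∣ % 3 ≡ 1
  16x≡1 = subst (λ k → k % 3 ≡ 1) (sym (ℤ.abs-* (+ 16) x))
    (*-≡1-mod 3 16 ∣ x ∣ refl
      (divisor≡1 ∣ x ∣ (∣-trans (m∣m*n ∣ y ∣) (m∣m*n ∣ z ∣))))
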